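{- Fix an integer $k\geq 3$. Then, as $r\to\infty$ (over integers $r\geq 2$), \[ M_r(k)=3\,\frac{(r(k-2))!}{((k-2)!)^r}\,(1+o_{r\to\infty}(1)). \]
   Context: For each integer $r\geq 2$, $M_r:\mathbb{Z}_{\geq 2}^r\to\mathbb{Z}_{\geq 0}$ denotes the family of functions uniquely determined by: (i) $M_2(k_1,k_2)=\binom{k_1+k_2-2}{k_1-1}$ for $k_1,k_2\geq 2$; (ii) for $r\geq 2$ and $k_1,\dots,k_r\geq 2$, inserting a coordinate equal to $2$ at any position of $(k_1,\dots,k_r)$ gives an $(r+1)$-tuple at which $M_{r+1}$ equals $M_r(k_1,\dots,k_r)$; (iii) for $k_1,\dots,k_r\geq 3$, $M_r(k_1,\dots,k_r)=\sum_{i=1}^r M_r(k_1,\dots,k_i-1,\dots,k_r)$ (the $i$-th coordinate decreased by $1$). $M_r(k)$ means $M_r(k,\dots,k)$. $o_{r\to\infty}(1)$ denotes a quantity tending to $0$ as $r\to\infty$. -}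

module Defs where

open import Data.Nat using (ℕ; _+_; _*_; _∸_; _^_; _≤_; suc; pred; ∣_-_∣)
open import Data.Nat.Combinatorics using (_C_)
open import Data.Fin using (Fin)
open import Data.Vec using (Vec; []; _∷_; insertAt; updateAt; sum; tabulate)
open import Data.Vec.Relation.Unary.All using (All)
open import Relation.Binary.PropositionalEquality using (_≡_)

-- A family M_r : ℤ_{≥2}^r → ℤ_{≥0}, represented as M r : Vec ℕ r → ℕ
-- (values outside ℤ_{≥2}^r are irrelevant), satisfying the three
-- defining properties (i)–(iii) of the paper, which determine it uniquely.
record IsMFamily (M : (r : ℕ) → Vec ℕ r → ℕ) : Set where
  field
    base : ∀ k₁ k₂ → 2 ≤ k₁ → 2 ≤ k₂ →
           M 2 (k₁ ∷ k₂ ∷ []) ≡ (k₁ + k₂ ∸ 2) C (k₁ ∸ 1)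
    insert2 : ∀ r → 2 ≤ r → (ks : Vec ℕ r) → All (2 ≤_) ks →
              (i : Fin (suc r)) → M (suc r) (insertAt ks i 2) ≡ M r ks
    recur : ∀ r → 2 ≤ r → (ks : Vec ℕ r) → All (3 ≤_) ks →
            M r ks ≡ sum (tabulate (λ i → M r (updateAt ks i pred)))

{-# OPTIONS --safe #-}
-- Put a_i = k_i − 2 and S = Σ a_i.  The family has the closed form
--   M_r(k) · Π a_i! = Φ(a) := 2·S! + Σ_i h_S(a_i),   h_S(x) = x·S!/(S − x + 1).
-- Multiplied by Π a_i!, rule (iii) reads Φ(a) = Σ_j a_j·Φ(a − e_j), which Φ satisfies because
-- h obeys the Pascal rule h_S(x) = x·h_{S−1}(x − 1) + (S − x)·h_{S−1}(x); rules (i) and (ii)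
-- are direct, so both sides agree by induction on Σ k_i.  On the diagonal a_i = a = k − 2 this
-- gives M_r(k)·(a!)^r = 3·(ra)! + D with ((r − 1)a + 1)·D = (a − 1)·(ra)!, a relative error O(1/r).
module Submission where

open import Defs
open import Data.Nat
  using (ℕ; zero; suc; pred; _+_; _*_; _∸_; _^_; _≤_; _<_; z≤n; s≤s; s≤s⁻¹; ∣_-_∣; _!; _≟_; >-nonZero)
open import Data.Nat.Properties
open import Data.Nat.Tactic.RingSolver using (solve-∀)
open import Data.Nat.Combinatorics using (_C_; nCk≡n!/k![n-k]!; k![n∸k]!∣n!)
open import Data.Nat.DivMod using (m/n*n≡m)
open import Data.Fin using (Fin; zero; suc)
open import Data.Vec using (Vec; []; _∷_; replicate; insertAt; updateAt; sum; tabulate; map; lookup; allFin)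
open import Data.Vec.Properties
  using (tabulate-allFin; tabulate-cong; map-∘; map-id; map-cong; map-lookup-allFin; map-replicate; map-insertAt; map-updateAt)
open import Data.Vec.Relation.Unary.All as All using (All; []; _∷_)
open import Data.Vec.Relation.Unary.All.Properties using (lookup⁺; map⁺)
open import Data.Product using (∃-syntax; _,_; _×_)
open import Data.Sum using (_⊎_; inj₁; inj₂)
open import Function using (_∘_)
open import Relation.Nullary using (yes; no; contradiction)
open import Relation.Binary.PropositionalEquality using (_≡_; refl; sym; trans; cong; cong₂; subst)

open import Algebra.Properties.CommutativeSemigroup +-commutativeSemigroup
  using () renaming (interchange to +-interchange; x∙yz≈y∙xz to x+[y+z]≡y+[x+z];
                     xy∙z≈xz∙y to x+y+z≡x+z+y; xy∙z≈zy∙x to x+y+z≡z+y+x)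
open import Algebra.Properties.CommutativeSemigroup *-commutativeSemigroup
  using () renaming (x∙yz≈y∙xz to x*[y*z]≡y*[x*z]; xy∙z≈y∙xz to x*y*z≡y*[x*z])

open ≤-Reasoning

module _ {ℓ} {A : Set ℓ} where

  sum-map-+ : ∀ {n} (f g : A → ℕ) (xs : Vec A n) →
              sum (map (λ x → f x + g x) xs) ≡ sum (map f xs) + sum (map g xs)
  sum-map-+ f g []       = refl
  sum-map-+ f g (x ∷ xs) =
    trans (cong (f x + g x +_) (sum-map-+ f g xs)) (+-interchange (f x) (g x) _ _)

  sum-map-*ʳ : ∀ {n} (f : A → ℕ) c (xs : Vec A n) → sum (map (λ x → f x * c) xs) ≡ sum (map f xs) * c
  sum-map-*ʳ f c []       = refl
  sum-map-*ʳ f c (x ∷ xs) = trans (cong (f x * c +_) (sum-map-*ʳ f c xs)) (sym (*-distribʳ-+ c (f x) _))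

  sum-map-cong : ∀ {n p} {P : A → Set p} {f g : A → ℕ} {xs : Vec A n} →
                 (∀ {x} → P x → f x ≡ g x) → All P xs → sum (map f xs) ≡ sum (map g xs)
  sum-map-cong f≡g []         = refl
  sum-map-cong f≡g (px ∷ pxs) = cong₂ _+_ (f≡g px) (sum-map-cong f≡g pxs)

  sum-map-updateAt : ∀ {n} (w : A → ℕ) (xs : Vec A n) i (f : A → A) →
                     sum (map w (updateAt xs i f)) + w (lookup xs i) ≡ sum (map w xs) + w (f (lookup xs i))
  sum-map-updateAt w (x ∷ xs) zero    f = x+y+z≡z+y+x (w (f x)) (sum (map w xs)) (w x)
  sum-map-updateAt w (x ∷ xs) (suc i) f = begin-equality
    w x + sum (map w (updateAt xs i f)) + w (lookup xs i) ≡⟨ +-assoc (w x) _ _ ⟩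
    w x + (sum (map w (updateAt xs i f)) + w (lookup xs i)) ≡⟨ cong (w x +_) (sum-map-updateAt w xs i f) ⟩
    w x + (sum (map w xs) + w (f (lookup xs i))) ≡⟨ +-assoc (w x) _ _ ⟨
    w x + sum (map w xs) + w (f (lookup xs i)) ∎

sum-map-lookup-allFin : ∀ {n} (w : ℕ → ℕ) (xs : Vec ℕ n) →
                        sum (map (λ j → w (lookup xs j)) (allFin n)) ≡ sum (map w xs)
sum-map-lookup-allFin {n} w xs =
  cong sum (trans (map-∘ w (lookup xs) (allFin n)) (cong (map w) (map-lookup-allFin xs)))

sum-tabulate-*ʳ : ∀ {n} (f : Fin n → ℕ) c → sum (tabulate f) * c ≡ sum (tabulate (λ j → f j * c))
sum-tabulate-*ʳ {n} f c = begin-equality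
  sum (tabulate f) * c                     ≡⟨ cong (λ v → sum v * c) (tabulate-allFin f) ⟩
  sum (map f (allFin n)) * c               ≡⟨ sum-map-*ʳ f c (allFin n) ⟨
  sum (map (λ j → f j * c) (allFin n))     ≡⟨ cong sum (tabulate-allFin (λ j → f j * c)) ⟨
  sum (tabulate (λ j → f j * c))           ∎

sum-updateAt-pred : ∀ {n} (xs : Vec ℕ n) i → 1 ≤ lookup xs i → suc (sum (updateAt xs i pred)) ≡ sum xs
sum-updateAt-pred (suc x ∷ xs) zero    _   = refl
sum-updateAt-pred (x ∷ xs)     (suc i) x≥1 =
  trans (sym (+-suc x _)) (cong (x +_) (sum-updateAt-pred xs i x≥1))

sum-insertAt : ∀ {n} (xs : Vec ℕ n) i x → sum (insertAt xs i x) ≡ x + sum xs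
sum-insertAt xs       zero    x = refl
sum-insertAt (y ∷ xs) (suc i) x = trans (cong (y +_) (sum-insertAt xs i x)) (x+[y+z]≡y+[x+z] y x (sum xs))

sum-replicate : ∀ r t → sum (replicate r t) ≡ r * t
sum-replicate zero    t = refl
sum-replicate (suc r) t = cong (t +_) (sum-replicate r t)

≤-sum : ∀ {n} (xs : Vec ℕ n) → All (_≤ sum xs) xs
≤-sum []       = []
≤-sum (x ∷ xs) = m≤m+n x (sum xs) ∷ All.map (λ {y} y≤ → ≤-trans y≤ (m≤n+m (sum xs) x)) (≤-sum xs)

<-sum : ∀ {n} (xs : Vec ℕ (2 + n)) → All (1 ≤_) xs → All (_< sum xs) xs
<-sum (x ∷ y ∷ xs) (x≥1 ∷ y≥1 ∷ _) =
  m<m+n x (≤-trans y≥1 (m≤m+n y (sum xs))) ∷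
  All.map (λ {z} z≤ → +-mono-≤ x≥1 z≤) (≤-sum (y ∷ xs))

All-replicate : ∀ {p} {P : ℕ → Set p} {x} r → P x → All P (replicate r x)
All-replicate zero    px = []
All-replicate (suc r) px = px ∷ All-replicate r px

All-updateAt-pred : ∀ {m n} {xs : Vec ℕ n} j → All (suc m ≤_) xs → All (m ≤_) (updateAt xs j pred)
All-updateAt-pred zero    (x>m ∷ xs>m) = suc[m]≤n⇒m≤pred[n] x>m ∷ All.map <⇒≤ xs>m
All-updateAt-pred (suc j) (x>m ∷ xs>m) = <⇒≤ x>m ∷ All-updateAt-pred j xs>m

pred[m]∸2≡pred[m∸2] : ∀ m → pred m ∸ 2 ≡ pred (m ∸ 2)
pred[m]∸2≡pred[m∸2] zero                = refl
pred[m]∸2≡pred[m∸2] (suc zero)          = refl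
pred[m]∸2≡pred[m∸2] (suc (suc zero))    = refl
pred[m]∸2≡pred[m∸2] (suc (suc (suc m))) = refl

insert2⊎All≥3 : ∀ {m} (ks : Vec ℕ (suc m)) → All (2 ≤_) ks →
  (∃[ p ] ∃[ ks′ ] ks ≡ insertAt ks′ p 2 × All (2 ≤_) ks′) ⊎ All (3 ≤_) ks
insert2⊎All≥3 (k ∷ ks) (k≥2 ∷ ks≥2) with k ≟ 2
... | yes refl = inj₁ (zero , ks , refl , ks≥2)
insert2⊎All≥3 {zero}  (k ∷ []) (k≥2 ∷ []) | no k≢2 = inj₂ (≤∧≢⇒< k≥2 (k≢2 ∘ sym) ∷ [])
insert2⊎All≥3 {suc m} (k ∷ ks) (k≥2 ∷ ks≥2) | no k≢2 with insert2⊎All≥3 ks ks≥2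
... | inj₁ (p , ks′ , refl , ks′≥2) = inj₁ (suc p , k ∷ ks′ , refl , k≥2 ∷ ks′≥2)
... | inj₂ ks≥3                     = inj₂ (≤∧≢⇒< k≥2 (k≢2 ∘ sym) ∷ ks≥3)

productFactorials : ∀ {n} → Vec ℕ n → ℕ
productFactorials []       = 1
productFactorials (x ∷ xs) = x ! * productFactorials xs

productFactorials-insertAt-zero : ∀ {n} (xs : Vec ℕ n) p →
                                  productFactorials (insertAt xs p 0) ≡ productFactorials xs
productFactorials-insertAt-zero xs       zero    = +-identityʳ (productFactorials xs)
productFactorials-insertAt-zero (x ∷ xs) (suc p) = cong (x ! *_) (productFactorials-insertAt-zero xs p)

productFactorials-updateAt-pred : ∀ {n} (xs : Vec ℕ n) j → 1 ≤ lookup xs j →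
  productFactorials xs ≡ lookup xs j * productFactorials (updateAt xs j pred)
productFactorials-updateAt-pred (suc x ∷ xs) zero    _   = *-assoc (suc x) (x !) (productFactorials xs)
productFactorials-updateAt-pred (x ∷ xs)     (suc j) x≥1 =
  trans (cong (x ! *_) (productFactorials-updateAt-pred xs j x≥1)) (x*[y*z]≡y*[x*z] (x !) (lookup xs j) _)

productFactorials-replicate : ∀ r t → productFactorials (replicate r t) ≡ (t !) ^ r
productFactorials-replicate zero    t = refl
productFactorials-replicate (suc r) t = cong (t ! *_) (productFactorials-replicate r t)

nCk*[k!*[n∸k]!]≡n! : ∀ {n k} → k ≤ n → (n C k) * (k ! * (n ∸ k) !) ≡ n !
nCk*[k!*[n∸k]!]≡n! {n} {k} k≤n =
  trans (cong (_* (k ! * (n ∸ k) !)) (nCk≡n!/k![n-k]! k≤n)) (m/n*n≡m (k![n∸k]!∣n! k≤n))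
  where instance _ = k !* (n ∸ k) !≢0

-- factorialQuot b s = (b + 1 + s)!/(s + 1) and share a s = a·(a + s)!/(s + 1), computed without division;
-- summand S x is h_S(x) and closedForm a is Φ(a).
factorialQuot : ℕ → ℕ → ℕ
factorialQuot zero    s = s !
factorialQuot (suc b) s = (2 + b + s) * factorialQuot b s

share : ℕ → ℕ → ℕ
share zero    s = 0
share (suc b) s = suc b * factorialQuot b s

suc-*-factorialQuot : ∀ b s → suc s * factorialQuot b s ≡ (suc b + s) !
suc-*-factorialQuot zero    s = refl
suc-*-factorialQuot (suc b) s =
  trans (x*[y*z]≡y*[x*z] (suc s) (2 + b + s) (factorialQuot b s)) (cong ((2 + b + s) *_) (suc-*-factorialQuot b s))

suc-*-share : ∀ a s → suc s * share a s ≡ a * (a + s) !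
suc-*-share zero    s = *-zeroʳ (suc s)
suc-*-share (suc b) s =
  trans (x*[y*z]≡y*[x*z] (suc s) (suc b) _) (cong (suc b *_) (suc-*-factorialQuot b s))

share-pascal : ∀ b t → share (suc b) (suc t) ≡ suc b * share b (suc t) + suc t * share (suc b) t
share-pascal b t = *-cancelˡ-≡ _ _ (suc q * q) (begin-equality
  suc q * q * L                                  ≡⟨ x*y*z≡y*[x*z] (suc q) q L ⟩
  q * (suc q * L)                                ≡⟨ cong (q *_) qL ⟩
  q * (suc b * (suc (b + q) * F))                ≡⟨ split b q F ⟩
  q * suc b * (b * F) + suc q * q * (suc b * F)  ≡⟨ cong₂ (λ u v → q * suc b * u + suc q * q * v) qX qY ⟨
  q * suc b * (suc q * X) + suc q * q * (q * Y)  ≡⟨ collect b q X Y ⟩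
  suc q * q * (suc b * X + q * Y)                ∎)
  where
  q = suc t
  F = (b + q) !
  X = share b q
  Y = share (suc b) t
  L = share (suc b) q
  qX : suc q * X ≡ b * F
  qX = suc-*-share b q
  qY : q * Y ≡ suc b * F
  qY = trans (suc-*-share (suc b) t) (cong (λ m → suc b * m !) (sym (+-suc b t)))
  qL : suc q * L ≡ suc b * (suc (b + q) * F)
  qL = suc-*-share (suc b) q
  split : ∀ b q F → q * (suc b * (suc (b + q) * F)) ≡ q * suc b * (b * F) + suc q * q * (suc b * F)
  split = solve-∀
  collect : ∀ b q X Y → q * suc b * (suc q * X) + suc q * q * (q * Y) ≡ suc q * q * (suc b * X + q * Y)
  collect = solve-∀

summand : ℕ → ℕ → ℕ
summand S x = share x (S ∸ x)

summand-pascal : ∀ {S x} → 1 ≤ x → x < S →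
                 summand S x ≡ x * summand (pred S) (pred x) + (S ∸ x) * summand (pred S) x
summand-pascal {suc T} {suc b} _ (s≤s b<T) rewrite +-∸-assoc 1 b<T = share-pascal b (T ∸ suc b)

closedForm : ∀ {n} → Vec ℕ n → ℕ
closedForm a = 2 * (sum a) ! + sum (map (summand (sum a)) a)

closedForm-sum : ∀ {n} (a : Vec ℕ n) {S} → sum a ≡ S → closedForm a ≡ 2 * S ! + sum (map (summand S) a)
closedForm-sum a = cong (λ S → 2 * S ! + sum (map (summand S) a))

closedForm-updateAt-pred : ∀ {n} (a : Vec ℕ n) j → 1 ≤ lookup a j →
  let T = pred (sum a) in
  closedForm (updateAt a j pred) + summand T (lookup a j)
    ≡ 2 * T ! + sum (map (summand T) a) + summand T (pred (lookup a j))
closedForm-updateAt-pred a j x≥1 = begin-equality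
  closedForm u + h x                   ≡⟨ cong (_+ h x) (closedForm-sum u (cong pred (sum-updateAt-pred a j x≥1))) ⟩
  2 * T ! + sum (map h u) + h x        ≡⟨ +-assoc (2 * T !) _ _ ⟩
  2 * T ! + (sum (map h u) + h x)      ≡⟨ cong (2 * T ! +_) (sum-map-updateAt h a j pred) ⟩
  2 * T ! + (sum (map h a) + h (pred x)) ≡⟨ +-assoc (2 * T !) _ _ ⟨
  2 * T ! + sum (map h a) + h (pred x) ∎
  where
  T = pred (sum a)
  h = summand T
  u = updateAt a j pred
  x = lookup a j

closedForm-pascal : ∀ {n} (a : Vec ℕ (2 + n)) → All (1 ≤_) a →
  closedForm a ≡ sum (tabulate (λ j → lookup a j * closedForm (updateAt a j pred)))
closedForm-pascal {n} a a≥1 = +-cancelʳ-≡ Σxh _ _ (trans expand-left (sym expand-right))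
  where
  S = sum a
  T = pred S
  h = summand T
  H = sum (map h a)
  Σxh = sum (map (λ x → x * h x) a)
  Σxh′ = sum (map (λ x → x * h (pred x)) a)
  S≡sucT : S ≡ suc T
  S≡sucT = sym (suc-pred S {{>-nonZero (≤-trans (lookup⁺ a≥1 zero) (lookup⁺ (≤-sum a) zero))}})
  expand-left : closedForm a + Σxh ≡ S * (2 * T !) + S * H + Σxh′
  expand-left = begin-equality
    2 * S ! + sum (map (summand S) a) + Σxh ≡⟨ cong (λ v → 2 * S ! + v + Σxh) summand-split ⟩
    2 * S ! + (Σxh′ + Σsh) + Σxh            ≡⟨ cong (_+ Σxh) (+-assoc (2 * S !) Σxh′ Σsh) ⟨
    2 * S ! + Σxh′ + Σsh + Σxh              ≡⟨ +-assoc (2 * S ! + Σxh′) Σsh Σxh ⟩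
    2 * S ! + Σxh′ + (Σsh + Σxh)            ≡⟨ cong₂ (λ u v → u + Σxh′ + v) 2*S!≡S*[2*T!] Σsh+Σxh≡S*H ⟩
    S * (2 * T !) + Σxh′ + S * H            ≡⟨ x+y+z≡x+z+y (S * (2 * T !)) Σxh′ (S * H) ⟩
    S * (2 * T !) + S * H + Σxh′            ∎
    where
    Σsh = sum (map (λ x → (S ∸ x) * h x) a)
    summand-split : sum (map (summand S) a) ≡ Σxh′ + Σsh
    summand-split = trans
      (sum-map-cong (λ (x≥1 , x<S) → summand-pascal x≥1 x<S) (All.zip (a≥1 , <-sum a a≥1)))
      (sum-map-+ _ _ a)
    2*S!≡S*[2*T!] : 2 * S ! ≡ S * (2 * T !)
    2*S!≡S*[2*T!] rewrite S≡sucT = x*[y*z]≡y*[x*z] 2 (suc T) (T !)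
    Σsh+Σxh≡S*H : Σsh + Σxh ≡ S * H
    Σsh+Σxh≡S*H = begin-equality
      Σsh + Σxh                       ≡⟨ sum-map-+ _ _ a ⟨
      sum (map (λ x → (S ∸ x) * h x + x * h x) a) ≡⟨ sum-map-cong collect (≤-sum a) ⟩
      sum (map (λ x → h x * S) a)     ≡⟨ sum-map-*ʳ h S a ⟩
      H * S                           ≡⟨ *-comm H S ⟩
      S * H                           ∎
      where
      collect : ∀ {x} → x ≤ S → (S ∸ x) * h x + x * h x ≡ h x * S
      collect {x} x≤S = begin-equality
        (S ∸ x) * h x + x * h x ≡⟨ *-distribʳ-+ (h x) (S ∸ x) x ⟨
        (S ∸ x + x) * h x       ≡⟨ cong (_* h x) (m∸n+n≡m x≤S) ⟩
        S * h x                 ≡⟨ *-comm S (h x) ⟩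
        h x * S                 ∎
  expand-right : sum (tabulate (λ j → lookup a j * closedForm (updateAt a j pred))) + Σxh
                 ≡ S * (2 * T !) + S * H + Σxh′
  expand-right = begin-equality
    sum (tabulate φ) + Σxh
      ≡⟨ cong₂ _+_ (cong sum (tabulate-allFin φ)) (sym (sum-map-lookup-allFin (λ x → x * h x) a)) ⟩
    sum (map φ J) + sum (map (λ j → lookup a j * h (lookup a j)) J)
      ≡⟨ sum-map-+ φ _ J ⟨
    sum (map (λ j → φ j + lookup a j * h (lookup a j)) J)
      ≡⟨ cong sum (map-cong step J) ⟩
    sum (map (λ j → w (lookup a j)) J)
      ≡⟨ sum-map-lookup-allFin w a ⟩
    sum (map w a)
      ≡⟨ sum-map-+ _ _ a ⟩
    sum (map (λ x → x * c) a) + Σxh′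
      ≡⟨ cong (_+ Σxh′) (trans (sum-map-*ʳ (λ x → x) c a) (cong (λ v → sum v * c) (map-id a))) ⟩
    S * c + Σxh′
      ≡⟨ cong (_+ Σxh′) (*-distribˡ-+ S _ H) ⟩
    S * (2 * T !) + S * H + Σxh′ ∎
    where
    J = allFin (2 + n)
    c = 2 * T ! + H
    φ : Fin (2 + n) → ℕ
    φ j = lookup a j * closedForm (updateAt a j pred)
    w : ℕ → ℕ
    w x = x * c + x * h (pred x)
    step : ∀ j → φ j + lookup a j * h (lookup a j) ≡ w (lookup a j)
    step j = begin-equality
      x * closedForm (updateAt a j pred) + x * h x ≡⟨ *-distribˡ-+ x _ _ ⟨
      x * (closedForm (updateAt a j pred) + h x)   ≡⟨ cong (x *_) (closedForm-updateAt-pred a j (lookup⁺ a≥1 j)) ⟩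
      x * (2 * T ! + H + h (pred x))               ≡⟨ *-distribˡ-+ x _ _ ⟩
      w x                                          ∎
      where x = lookup a j

closedForm-insertAt-zero : ∀ {n} (a : Vec ℕ n) p → closedForm (insertAt a p 0) ≡ closedForm a
closedForm-insertAt-zero a p = begin-equality
  closedForm (insertAt a p 0)              ≡⟨ closedForm-sum (insertAt a p 0) (sum-insertAt a p 0) ⟩
  2 * (sum a) ! + sum (map h (insertAt a p 0)) ≡⟨ cong (λ v → 2 * (sum a) ! + sum v) (map-insertAt h 0 a p) ⟩
  2 * (sum a) ! + sum (insertAt (map h a) p 0) ≡⟨ cong (2 * (sum a) ! +_) (sum-insertAt (map h a) p 0) ⟩
  closedForm a                             ∎
  where h = summand (sum a)

suc-*-suc-*-closedForm-pair : ∀ a b → suc a * suc b * closedForm (a ∷ b ∷ []) ≡ (2 + a + b) !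
suc-*-suc-*-closedForm-pair a b = begin-equality
  suc a * suc b * closedForm (a ∷ b ∷ [])                             ≡⟨ cong (suc a * suc b *_) unfold ⟩
  suc a * suc b * (2 * F + (X + Y))                                   ≡⟨ expand a b F X Y ⟩
  2 * (suc a * suc b) * F + suc a * (suc b * X) + suc b * (suc a * Y) ≡⟨ cong₂ (λ u v → G + suc a * u + suc b * v) bX aY ⟩
  2 * (suc a * suc b) * F + suc a * (a * F) + suc b * (b * F)         ≡⟨ collect a b F ⟩
  (2 + a + b) * ((1 + a + b) * F)                                     ∎
  where
  F = (a + b) !
  G = 2 * (suc a * suc b) * F
  X = share a b
  Y = share b a
  unfold : closedForm (a ∷ b ∷ []) ≡ 2 * F + (X + Y)
  unfold rewrite +-identityʳ b | m+n∸m≡n a b | m+n∸n≡m a b | +-identityʳ Y = refl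
  bX : suc b * X ≡ a * F
  bX = suc-*-share a b
  aY : suc a * Y ≡ b * F
  aY = trans (suc-*-share b a) (cong (λ m → b * m !) (+-comm b a))
  expand : ∀ a b F X Y → suc a * suc b * (2 * F + (X + Y))
                         ≡ 2 * (suc a * suc b) * F + suc a * (suc b * X) + suc b * (suc a * Y)
  expand = solve-∀
  collect : ∀ a b F → 2 * (suc a * suc b) * F + suc a * (a * F) + suc b * (b * F)
                      ≡ (2 + a + b) * ((1 + a + b) * F)
  collect = solve-∀

closedForm-pair : ∀ a b →
                  ((a + suc (suc b)) C suc a) * productFactorials (a ∷ b ∷ []) ≡ closedForm (a ∷ b ∷ [])
closedForm-pair a b rewrite +-suc a (suc b) = *-cancelˡ-≡ _ _ (suc a * suc b) (begin-equality
  suc a * suc b * (c * (a ! * (b ! * 1)))   ≡⟨ regroup a b c (a !) (b !) ⟩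
  c * (suc a ! * suc b !)                   ≡⟨ cong (λ m → c * (suc a ! * m !)) n∸suc[a]≡suc[b] ⟨
  c * (suc a ! * (n ∸ suc a) !)             ≡⟨ nCk*[k!*[n∸k]!]≡n! (m≤m+n (suc a) (suc b)) ⟩
  n !                                       ≡⟨ cong _! n≡2+a+b ⟩
  (2 + a + b) !                             ≡⟨ suc-*-suc-*-closedForm-pair a b ⟨
  suc a * suc b * closedForm (a ∷ b ∷ [])   ∎)
  where
  n = suc a + suc b
  c = n C suc a
  n≡2+a+b : n ≡ 2 + a + b
  n≡2+a+b = cong suc (+-suc a b)
  n∸suc[a]≡suc[b] : n ∸ suc a ≡ suc b
  n∸suc[a]≡suc[b] = m+n∸m≡n (suc a) (suc b)
  regroup : ∀ a b c F G → suc a * suc b * (c * (F * (G * 1))) ≡ c * (suc a * F * (suc b * G))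
  regroup = solve-∀

closedForm-diagonal : ∀ r t → closedForm (replicate (suc r) t) ≡ 2 * (suc r * t) ! + suc r * share t (r * t)
closedForm-diagonal r t = begin-equality
  closedForm (replicate (suc r) t)
    ≡⟨ closedForm-sum (replicate (suc r) t) (sum-replicate (suc r) t) ⟩
  2 * S ! + sum (map (summand S) (replicate (suc r) t))
    ≡⟨ cong (λ v → 2 * S ! + sum v) (map-replicate (summand S) t (suc r)) ⟩
  2 * S ! + sum (replicate (suc r) (summand S t))
    ≡⟨ cong (2 * S ! +_) (sum-replicate (suc r) (summand S t)) ⟩
  2 * S ! + suc r * share t (t + r * t ∸ t)
    ≡⟨ cong (λ m → 2 * S ! + suc r * share t m) (m+n∸m≡n t (r * t)) ⟩
  2 * S ! + suc r * share t (r * t) ∎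
  where S = suc r * t

diagonal-excess : ∀ r u → let s = r * suc u; F = (suc r * suc u) ! in
  suc s * (suc r * share (suc u) s) ≡ suc s * F + u * F
diagonal-excess r u = begin-equality
  suc s * (suc r * share t s) ≡⟨ x*[y*z]≡y*[x*z] (suc s) (suc r) (share t s) ⟩
  suc r * (suc s * share t s) ≡⟨ cong (suc r *_) (suc-*-share t s) ⟩
  suc r * (t * F)             ≡⟨ *-assoc (suc r) t F ⟨
  (suc u + s) * F             ≡⟨ split u s F ⟩
  suc s * F + u * F           ∎
  where
  t = suc u
  s = r * t
  F = (t + s) !
  split : ∀ u s F → (suc u + s) * F ≡ suc s * F + u * F
  split = solve-∀

module _ (M : (r : ℕ) → Vec ℕ r → ℕ) (isM : IsMFamily M) where
  open IsMFamily isM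

  M*productFactorials≡closedForm : ∀ N r (ks : Vec ℕ r) → 2 ≤ r → All (2 ≤_) ks → sum ks ≤ N →
    M r ks * productFactorials (map (_∸ 2) ks) ≡ closedForm (map (_∸ 2) ks)
  M*productFactorials≡closedForm zero r (k ∷ ks) _ (k≥2 ∷ _) sum≤0 =
    contradiction (≤-trans k≥2 (m+n≤o⇒m≤o k sum≤0)) λ ()
  M*productFactorials≡closedForm (suc N) 1 _ (s≤s ()) _ _
  M*productFactorials≡closedForm (suc N) 2 (suc (suc a) ∷ suc (suc b) ∷ []) _
    (k₁≥2@(s≤s (s≤s z≤n)) ∷ k₂≥2@(s≤s (s≤s z≤n)) ∷ []) _ =
    trans (cong (_* productFactorials (a ∷ b ∷ [])) (base _ _ k₁≥2 k₂≥2)) (closedForm-pair a b)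
  M*productFactorials≡closedForm (suc N) (suc (suc (suc r))) ks r≥2 ks≥2 sum≤ with insert2⊎All≥3 ks ks≥2
  ... | inj₁ (p , ks′ , refl , ks′≥2) rewrite map-insertAt (_∸ 2) 2 ks′ p = begin-equality
    M _ (insertAt ks′ p 2) * productFactorials (insertAt a′ p 0)
      ≡⟨ cong₂ _*_ (insert2 (2 + r) (s≤s (s≤s z≤n)) ks′ ks′≥2 p) (productFactorials-insertAt-zero a′ p) ⟩
    M _ ks′ * productFactorials a′
      ≡⟨ M*productFactorials≡closedForm N _ ks′ (s≤s (s≤s z≤n)) ks′≥2 sum′≤N ⟩
    closedForm a′
      ≡⟨ closedForm-insertAt-zero a′ p ⟨
    closedForm (insertAt a′ p 0) ∎
    where
    a′ = map (_∸ 2) ks′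
    sum′≤N : sum ks′ ≤ N
    sum′≤N = s≤s⁻¹ (≤-trans (n≤1+n _) (subst (_≤ suc N) (sum-insertAt ks′ p 2) sum≤))
  ... | inj₂ ks≥3 = begin-equality
    M _ ks * productFactorials a
      ≡⟨ cong (_* productFactorials a) (recur _ r≥2 ks ks≥3) ⟩
    sum (tabulate (λ j → M _ (updateAt ks j pred))) * productFactorials a
      ≡⟨ sum-tabulate-*ʳ (λ j → M _ (updateAt ks j pred)) (productFactorials a) ⟩
    sum (tabulate (λ j → M _ (updateAt ks j pred) * productFactorials a))
      ≡⟨ cong sum (tabulate-cong step) ⟩
    sum (tabulate (λ j → lookup a j * closedForm (updateAt a j pred)))
      ≡⟨ closedForm-pascal a a≥1 ⟨
    closedForm a ∎
    where
    a = map (_∸ 2) ks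
    a≥1 : All (1 ≤_) a
    a≥1 = map⁺ (All.map (λ k≥3 → m+n≤o⇒m≤o∸n 1 k≥3) ks≥3)
    step : ∀ j → M _ (updateAt ks j pred) * productFactorials a ≡ lookup a j * closedForm (updateAt a j pred)
    step j = begin-equality
      M _ u * productFactorials a
        ≡⟨ cong (M _ u *_) (productFactorials-updateAt-pred a j (lookup⁺ a≥1 j)) ⟩
      M _ u * (lookup a j * productFactorials (updateAt a j pred))
        ≡⟨ x*[y*z]≡y*[x*z] (M _ u) (lookup a j) _ ⟩
      lookup a j * (M _ u * productFactorials (updateAt a j pred))
        ≡⟨ cong (λ v → lookup a j * (M _ u * productFactorials v)) shift-updateAt ⟨
      lookup a j * (M _ u * productFactorials (map (_∸ 2) u))
        ≡⟨ cong (lookup a j *_) (M*productFactorials≡closedForm N _ u r≥2 u≥2 sum-u≤N) ⟩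
      lookup a j * closedForm (map (_∸ 2) u)
        ≡⟨ cong (λ v → lookup a j * closedForm v) shift-updateAt ⟩
      lookup a j * closedForm (updateAt a j pred) ∎
      where
      u = updateAt ks j pred
      shift-updateAt : map (_∸ 2) u ≡ updateAt a j pred
      shift-updateAt = map-updateAt ks j (pred[m]∸2≡pred[m∸2] (lookup ks j))
      u≥2 : All (2 ≤_) u
      u≥2 = All-updateAt-pred j ks≥3
      sum-u≤N : sum u ≤ N
      sum-u≤N = s≤s⁻¹ (subst (_≤ suc N) (sym (sum-updateAt-pred ks j (≤-trans (s≤s z≤n) (lookup⁺ ks≥3 j)))) sum≤)

  M-diagonal : ∀ r k → 2 ≤ r → 2 ≤ k →
               M r (replicate r k) * ((k ∸ 2) !) ^ r ≡ closedForm (replicate r (k ∸ 2))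
  M-diagonal r k r≥2 k≥2 = begin-equality
    M r (replicate r k) * ((k ∸ 2) !) ^ r
      ≡⟨ cong (M r (replicate r k) *_) (productFactorials-replicate r (k ∸ 2)) ⟨
    M r (replicate r k) * productFactorials (replicate r (k ∸ 2))
      ≡⟨ cong (λ v → M r (replicate r k) * productFactorials v) (map-replicate (_∸ 2) k r) ⟨
    M r (replicate r k) * productFactorials (map (_∸ 2) (replicate r k))
      ≡⟨ M*productFactorials≡closedForm _ r (replicate r k) r≥2 (All-replicate r k≥2) ≤-refl ⟩
    closedForm (map (_∸ 2) (replicate r k))
      ≡⟨ cong closedForm (map-replicate (_∸ 2) k r) ⟩
    closedForm (replicate r (k ∸ 2)) ∎

-- X = F + D with (c + 1)·D = u·F, and |2F + X − 3F| = D.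
excess-bound : ∀ {n c u F X} → suc c * X ≡ suc c * F + u * F → suc n * u ≤ suc c * 3 →
               suc n * ∣ 2 * F + X - 3 * F ∣ ≤ 3 * F
excess-bound {n} {c} {u} {F} {X} cX≡cF+uF nu≤3c = begin
  suc n * ∣ 2 * F + X - 3 * F ∣ ≡⟨ cong (suc n *_) ∣2F+X-3F∣≡D ⟩
  suc n * D                     ≤⟨ *-cancelˡ-≤ (suc c) c[nD]≤c[3F] ⟩
  3 * F                         ∎
  where
  F≤X : F ≤ X
  F≤X = *-cancelˡ-≤ (suc c) (subst (suc c * F ≤_) (sym cX≡cF+uF) (m≤m+n _ _))
  D = X ∸ F
  X≡F+D : X ≡ F + D
  X≡F+D = sym (m+[n∸m]≡n F≤X)
  ∣2F+X-3F∣≡D : ∣ 2 * F + X - 3 * F ∣ ≡ D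
  ∣2F+X-3F∣≡D = begin-equality
    ∣ 2 * F + X - 3 * F ∣       ≡⟨ cong (λ v → ∣ 2 * F + v - 3 * F ∣) X≡F+D ⟩
    ∣ 2 * F + (F + D) - 3 * F ∣ ≡⟨ cong (λ v → ∣ v - 3 * F ∣) (regroup F D) ⟩
    ∣ 3 * F + D - 3 * F ∣       ≡⟨ ∣-∣-comm (3 * F + D) (3 * F) ⟩
    ∣ 3 * F - 3 * F + D ∣       ≡⟨ ∣m-m+n∣≡n (3 * F) D ⟩
    D                           ∎
    where
    regroup : ∀ F D → 2 * F + (F + D) ≡ 3 * F + D
    regroup = solve-∀
  cD≡uF : suc c * D ≡ u * F
  cD≡uF = +-cancelˡ-≡ (suc c * F) _ _ (begin-equality
    suc c * F + suc c * D ≡⟨ *-distribˡ-+ (suc c) F D ⟨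
    suc c * (F + D)       ≡⟨ cong (suc c *_) X≡F+D ⟨
    suc c * X             ≡⟨ cX≡cF+uF ⟩
    suc c * F + u * F     ∎)
  c[nD]≤c[3F] : suc c * (suc n * D) ≤ suc c * (3 * F)
  c[nD]≤c[3F] = begin
    suc c * (suc n * D) ≡⟨ x*[y*z]≡y*[x*z] (suc c) (suc n) D ⟩
    suc n * (suc c * D) ≡⟨ cong (suc n *_) cD≡uF ⟩
    suc n * (u * F)     ≡⟨ *-assoc (suc n) u F ⟨
    suc n * u * F       ≤⟨ *-monoˡ-≤ F nu≤3c ⟩
    suc c * 3 * F       ≡⟨ *-assoc (suc c) 3 F ⟩
    suc c * (3 * F)     ∎

n<r⇒[1+n]*u≤[1+r*[1+u]]*3 : ∀ {n r} u → suc n ≤ r → suc n * u ≤ suc (r * suc u) * 3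
n<r⇒[1+n]*u≤[1+r*[1+u]]*3 {n} {r} u n<r = begin
  suc n * u           ≤⟨ *-mono-≤ n<r (n≤1+n u) ⟩
  r * suc u           ≤⟨ n≤1+n _ ⟩
  suc (r * suc u)     ≤⟨ m≤m*n (suc (r * suc u)) 3 ⟩
  suc (r * suc u) * 3 ∎

corollary3p6 : (M : (r : ℕ) → Vec ℕ r → ℕ) → IsMFamily M →
    ∀ k → 3 ≤ k → ∀ n → ∃[ R ] ∀ r → 2 ≤ r → R ≤ r →
      suc n * ∣ M r (replicate r k) * ((k ∸ 2) !) ^ r - 3 * ((r * (k ∸ 2)) !) ∣
        ≤ 3 * ((r * (k ∸ 2)) !)
corollary3p6 M isM (suc (suc (suc u))) (s≤s (s≤s (s≤s z≤n))) n = 2 + n , bound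
  where
  bound : ∀ r → 2 ≤ r → 2 + n ≤ r →
          suc n * ∣ M r (replicate r (3 + u)) * (suc u !) ^ r - 3 * (r * suc u) ! ∣ ≤ 3 * (r * suc u) !
  bound (suc r) r≥2 (s≤s n<r) =
    subst (λ v → suc n * ∣ v - 3 * F ∣ ≤ 3 * F)
      (sym (trans (M-diagonal M isM (suc r) (3 + u) r≥2 (s≤s (s≤s z≤n))) (closedForm-diagonal r (suc u))))
      (excess-bound {n} {r * suc u} {u} {F} {X} (diagonal-excess r u) (n<r⇒[1+n]*u≤[1+r*[1+u]]*3 u n<r))
    where
    F = (suc r * suc u) !
    X = suc r * share (suc u) (r * suc u)
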